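{- If $B\subset\mathcal{S}_n$ is $(1,1)$-guaranteed, then (i) for each $s\in\mathcal{S}_n$, $|N_n^1(s)\cap B|\ge1$ if $s\in B$ and $|N_n^1(s)\cap B|\ge n$ if $s\notin B$; and (ii) $|B|\ge|\mathcal{S}_n|/|\Sigma|=|\Sigma|^{n-1}$.
   Context: $\Sigma$ is a finite alphabet with $|\Sigma|>1$, $n\ge1$, $\mathcal{S}_n=\Sigma^n$ with the edit (Levenshtein) distance $\mathrm{edit}$. $N_n^r(s)=\{t\in\mathcal{S}_n:\mathrm{edit}(s,t)\le r\}$. A subset $B\subset\mathcal{S}_n$ is $(d_1,r)$-guaranteed if $N_n^r(s)\cap N_n^r(t)\cap B\neq\emptyset$ for every pair $s,t\in\mathcal{S}_n$ with $\mathrm{edit}(s,t)\le d_1$. -}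

module Defs where

open import Data.Nat using (ℕ; zero; suc; _+_; _≤_; _⊔_; _⊓_; _≤ᵇ_)
open import Data.Fin using (Fin)
open import Data.Fin.Properties using (_≟_)
open import Data.List using (List; []; _∷_; length; map; concatMap; filter; allFin)
open import Data.Vec using (Vec; toList)
import Data.Vec as V
open import Data.Bool using (Bool; true; false; _∧_)
open import Data.Product using (∃; _×_)
open import Relation.Nullary.Decidable using (does)
open import Relation.Binary.PropositionalEquality using (_≡_)

-- The alphabet Σ is Fin q; strings of length n are Vec (Fin q) n.

lev : ∀ {q} → List (Fin q) → List (Fin q) → ℕ
lev [] t = length t
lev (a ∷ s) [] = suc (length s)
lev (a ∷ s) (b ∷ t) =
  (suc (lev s (b ∷ t)) ⊓ suc (lev (a ∷ s) t))
    ⊓ (lev s t + (if does (a ≟ b) then 0 else 1))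
  where
  if_then_else_ : Bool → ℕ → ℕ → ℕ
  if true then x else y = x
  if false then x else y = y

edit : ∀ {q n} → Vec (Fin q) n → Vec (Fin q) n → ℕ
edit s t = lev (toList s) (toList t)

allStrings : ∀ q n → List (Vec (Fin q) n)
allStrings q zero = V.[] ∷ []
allStrings q (suc n) = concatMap (λ a → map (a V.∷_) (allStrings q n)) (allFin q)

Subset : ℕ → ℕ → Set
Subset q n = Vec (Fin q) n → Bool

card : ∀ {q n} → Subset q n → ℕ
card {q} {n} B = length (filter (λ t → B t Data.Bool.≟ true) (allStrings q n))

ballInter : ∀ {q n} → ℕ → Vec (Fin q) n → Subset q n → Subset q n
ballInter r s B t = B t ∧ (edit s t ≤ᵇ r)

Guaranteed : ∀ {q n} → ℕ → ℕ → Subset q n → Set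
Guaranteed {q} {n} d₁ r B =
  (s t : Vec (Fin q) n) → edit s t ≤ d₁ →
  ∃ λ u → edit s u ≤ r × edit t u ≤ r × B u ≡ true

{-# OPTIONS --safe #-}
-- For strings of equal length, edit distance at most 1 means at most one mismatching
-- position. If s ∉ B, apply the guarantee to s and the string t obtained by changing s at
-- a position j: the resulting u ∈ B is within distance 1 of both, and since u ≠ s it must
-- differ from s exactly at j. These n neighbours are pairwise distinct, which gives (i).
-- For (ii), every w ∈ Σⁿ⁻¹ is the tail of an element of B (0w itself, or its neighbour
-- differing only at the first letter), so dropping the first letter maps B onto Σⁿ⁻¹.
module Submission where

open import Defs
open import Data.Nat using (ℕ; zero; suc; _+_; _≤_; _⊓_; _^_; _∸_; z≤n; s≤s)
open import Data.Nat.Properties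
  using (⊓-sel; ≤-trans; ≤-reflexive; n≤1+n; m⊓n≤n; +-identityʳ; +-comm; m+n≤o⇒m≤o; m+n≤o⇒n≤o; +-cancelʳ-≤; n≤0⇒n≡0; ≤⇒≤ᵇ)
open import Data.Fin using (Fin; zero; suc; punchIn; combine; finToFun; funToFin)
open import Data.Fin.Properties using (_≟_; injective⇒≤; punchInᵢ≢i; funToFin-finToFin)
open import Data.List using (List; []; _∷_; length)
import Data.List as List
import Data.List.Properties as List
open import Data.List.Membership.Propositional using (_∈_)
open import Data.List.Membership.Propositional.Properties using (∈-filter⁺; ∈-concat⁺′; ∈-map⁺; ∈-allFin)
open import Data.List.Relation.Unary.Any using (here; index)
open import Data.List.Relation.Unary.Any.Properties using (lookup-index)
open import Data.Vec using (Vec; []; _∷_; toList; lookup; tail; tabulate; _[_]≔_)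
open import Data.Vec.Properties using (toList-injective; tabulate∘lookup; tabulate-cong; lookup∘tabulate; lookup∘update; lookup∘update′)
open import Data.Vec.Relation.Binary.Equality.Cast using (cast-is-id)
open import Data.Bool using (true; false) renaming (_≟_ to _≟ᵇ_)
open import Data.Bool.Properties using (T-≡)
open import Data.Product using (Σ; _×_; _,_; proj₁; proj₂)
open import Data.Sum using (_⊎_; inj₁; inj₂)
open import Data.Empty using (⊥-elim)
open import Function using (_∘_; Injective; Equivalence)
open import Relation.Nullary using (yes; no)
open import Relation.Binary.PropositionalEquality

m⊓n≤o⇒m≤o⊎n≤o : ∀ {m n o} → m ⊓ n ≤ o → m ≤ o ⊎ n ≤ o
m⊓n≤o⇒m≤o⊎n≤o {m} {n} h with ⊓-sel m n
... | inj₁ e = inj₁ (subst (_≤ _) e h)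
... | inj₂ e = inj₂ (subst (_≤ _) e h)

module _ {q : ℕ} where

  lev-∷-≤ : (a : Fin q) (s t : List (Fin q)) → lev (a ∷ s) (a ∷ t) ≤ lev s t
  lev-∷-≤ a s t with a ≟ a
  ... | yes _ = ≤-trans (m⊓n≤n _ _) (≤-reflexive (+-identityʳ _))
  ... | no a≢a = ⊥-elim (a≢a refl)

  lev-substitute-≤ : (a b : Fin q) (s t : List (Fin q)) → lev (a ∷ s) (b ∷ t) ≤ suc (lev s t)
  lev-substitute-≤ a b s t with a ≟ b
  ... | yes _ = ≤-trans (m⊓n≤n _ _) (≤-trans (≤-reflexive (+-identityʳ _)) (n≤1+n _))
  ... | no _ = ≤-trans (m⊓n≤n _ _) (≤-reflexive (+-comm _ 1))

  lev-refl : (s : List (Fin q)) → lev s s ≡ 0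
  lev-refl [] = refl
  lev-refl (a ∷ s) = n≤0⇒n≡0 (≤-trans (lev-∷-≤ a s s) (≤-reflexive (lev-refl s)))

  lev≤0⇒≡ : (s t : List (Fin q)) → lev s t ≤ 0 → s ≡ t
  lev≤0⇒≡ [] [] _ = refl
  lev≤0⇒≡ (a ∷ s) (b ∷ t) h with m⊓n≤o⇒m≤o⊎n≤o h
  ... | inj₁ h′ with m⊓n≤o⇒m≤o⊎n≤o h′
  ...   | inj₁ ()
  ...   | inj₂ ()
  lev≤0⇒≡ (a ∷ s) (b ∷ t) h | inj₂ h′ with a ≟ b
  ... | yes refl = cong (a ∷_) (lev≤0⇒≡ s t (m+n≤o⇒m≤o _ h′))
  ... | no _ with m+n≤o⇒n≤o (lev s t) h′
  ...   | ()

module _ {A : Set} where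

  toList-≢-∷ : ∀ {n} (s t : Vec A n) (b : A) → toList s ≢ b ∷ toList t
  toList-≢-∷ [] [] b ()
  toList-≢-∷ (x ∷ s) (y ∷ t) b e = toList-≢-∷ s t y (List.∷-injectiveʳ e)

  toList-injective′ : ∀ {n} (s t : Vec A n) → toList s ≡ toList t → s ≡ t
  toList-injective′ s t e = trans (sym (cast-is-id refl s)) (toList-injective refl s t e)

  lookup-extensionality : ∀ {n} (s t : Vec A n) → (∀ k → lookup s k ≡ lookup t k) → s ≡ t
  lookup-extensionality s t p = begin
    s                   ≡⟨ tabulate∘lookup s ⟨
    tabulate (lookup s) ≡⟨ tabulate-cong p ⟩
    tabulate (lookup t) ≡⟨ tabulate∘lookup t ⟩
    t                   ∎
    where open ≡-Reasoning

  AtMostOneMismatch : ∀ {n} → Vec A n → Vec A n → Set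
  AtMostOneMismatch s u = ∀ {i k} → lookup s i ≢ lookup u i → lookup s k ≢ lookup u k → i ≡ k

  ∷-atMostOneMismatch : ∀ {n} (a : A) {s u : Vec A n} →
    AtMostOneMismatch s u → AtMostOneMismatch (a ∷ s) (a ∷ u)
  ∷-atMostOneMismatch a m {zero}  d _ = ⊥-elim (d refl)
  ∷-atMostOneMismatch a m {suc i} {zero} _ d = ⊥-elim (d refl)
  ∷-atMostOneMismatch a m {suc i} {suc k} d d′ = cong suc (m d d′)

  differentHeads-atMostOneMismatch : ∀ {n} (a b : A) (s : Vec A n) → AtMostOneMismatch (a ∷ s) (b ∷ s)
  differentHeads-atMostOneMismatch a b s {zero}  {zero}  _ _ = refl
  differentHeads-atMostOneMismatch a b s {suc i} d _ = ⊥-elim (d refl)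
  differentHeads-atMostOneMismatch a b s {zero}  {suc k} _ d = ⊥-elim (d refl)

module _ {q : ℕ} where

  edit≤1⇒atMostOneMismatch : ∀ {n} (s u : Vec (Fin q) n) → edit s u ≤ 1 → AtMostOneMismatch s u
  edit≤1⇒atMostOneMismatch [] [] _ {()}
  edit≤1⇒atMostOneMismatch (a ∷ s) (b ∷ u) h with m⊓n≤o⇒m≤o⊎n≤o h
  ... | inj₁ h′ with m⊓n≤o⇒m≤o⊎n≤o h′
  ...   | inj₁ (s≤s deletion)  =
          ⊥-elim (toList-≢-∷ s u b (lev≤0⇒≡ (toList s) (b ∷ toList u) deletion))
  ...   | inj₂ (s≤s insertion) =
          ⊥-elim (toList-≢-∷ u s a (sym (lev≤0⇒≡ (a ∷ toList s) (toList u) insertion)))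
  edit≤1⇒atMostOneMismatch (a ∷ s) (b ∷ u) h | inj₂ h′ with a ≟ b
  ... | yes refl = ∷-atMostOneMismatch a (edit≤1⇒atMostOneMismatch s u (m+n≤o⇒m≤o _ h′))
  ... | no _ with toList-injective′ s u (lev≤0⇒≡ (toList s) (toList u) (+-cancelʳ-≤ 1 _ 0 h′))
  ...   | refl = differentHeads-atMostOneMismatch a b s

  atMostOneMismatch-agree : ∀ {n} {s u : Vec (Fin q) n} {j} → AtMostOneMismatch s u →
    lookup s j ≢ lookup u j → ∀ k → k ≢ j → lookup s k ≡ lookup u k
  atMostOneMismatch-agree {s = s} {u} m d k k≢j with lookup s k ≟ lookup u k
  ... | yes e = e
  ... | no d′ = ⊥-elim (k≢j (m d′ d))

  edit-refl : ∀ {n} (s : Vec (Fin q) n) → edit s s ≡ 0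
  edit-refl s = lev-refl (toList s)

  edit-[]≔≤1 : ∀ {n} (s : Vec (Fin q) n) j c → edit s (s [ j ]≔ c) ≤ 1
  edit-[]≔≤1 (x ∷ s) zero c =
    ≤-trans (lev-substitute-≤ x c (toList s) (toList s)) (≤-reflexive (cong suc (edit-refl s)))
  edit-[]≔≤1 (x ∷ s) (suc j) c = ≤-trans (lev-∷-≤ x (toList s) _) (edit-[]≔≤1 s j c)

injective-into⇒≤-length : ∀ {A : Set} {m} {xs : List A} (f : Fin m → A) →
  Injective _≡_ _≡_ f → (∀ i → f i ∈ xs) → m ≤ length xs
injective-into⇒≤-length {xs = xs} f f-inj f∈xs = injective⇒≤ {f = index ∘ f∈xs} index-inj
  where
  index-inj : Injective _≡_ _≡_ (index ∘ f∈xs)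
  index-inj {i} {j} e =
    f-inj (trans (lookup-index (f∈xs i)) (trans (cong (List.lookup xs) e) (sym (lookup-index (f∈xs j)))))

∈-allStrings : ∀ {q n} (v : Vec (Fin q) n) → v ∈ allStrings q n
∈-allStrings [] = here refl
∈-allStrings {q} {suc n} (a ∷ v) =
  ∈-concat⁺′ (∈-map⁺ (a ∷_) (∈-allStrings v)) (∈-map⁺ (λ b → List.map (b ∷_) (allStrings q n)) (∈-allFin a))

injective⇒≤-card : ∀ {q n m} (B : Subset q n) (f : Fin m → Vec (Fin q) n) →
  Injective _≡_ _≡_ f → (∀ i → B (f i) ≡ true) → m ≤ card B
injective⇒≤-card B f f-inj f∈B =
  injective-into⇒≤-length f f-inj (λ i → ∈-filter⁺ (λ t → B t ≟ᵇ true) (∈-allStrings (f i)) (f∈B i))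

ballInter-intro : ∀ {q n r} (B : Subset q n) s {u} → B u ≡ true → edit s u ≤ r → ballInter r s B u ≡ true
ballInter-intro B s Bu h rewrite Bu = Equivalence.to T-≡ (≤⇒≤ᵇ h)

funToFin-cong : ∀ {m n} {f g : Fin m → Fin n} → (∀ i → f i ≡ g i) → funToFin f ≡ funToFin g
funToFin-cong {zero}  _ = refl
funToFin-cong {suc m} p = cong₂ combine (p zero) (funToFin-cong (p ∘ suc))

decode : ∀ {q} m → Fin (q ^ m) → Vec (Fin q) m
decode m = tabulate ∘ finToFun

decode-injective : ∀ {q} m → Injective _≡_ _≡_ (decode {q} m)
decode-injective {q} m {i} {j} e = begin
  i                              ≡⟨ funToFin-finToFin {m} {q} i ⟨
  funToFin (finToFun {q} {m} i)  ≡⟨ funToFin-cong finToFun-i≗j ⟩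
  funToFin (finToFun {q} {m} j)  ≡⟨ funToFin-finToFin {m} {q} j ⟩
  j                              ∎
  where
  open ≡-Reasoning
  finToFun-i≗j : ∀ k → finToFun i k ≡ finToFun j k
  finToFun-i≗j k = trans (sym (lookup∘tabulate (finToFun i) k))
    (trans (cong (λ v → lookup v k) e) (lookup∘tabulate (finToFun j) k))

record NeighbourAt {q n} (B : Subset q n) (s : Vec (Fin q) n) (j : Fin n) : Set where
  field
    point    : Vec (Fin q) n
    inB      : B point ≡ true
    close    : edit s point ≤ 1
    differs  : lookup s j ≢ lookup point j

  agreesOff : ∀ k → k ≢ j → lookup s k ≡ lookup point k
  agreesOff = atMostOneMismatch-agree {s = s} {point} (edit≤1⇒atMostOneMismatch s point close) differs

open NeighbourAt

neighbourAt : ∀ {q n} {B : Subset q n} → Guaranteed 1 1 B → ∀ {s} → B s ≡ false →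
  (j : Fin n) (c : Fin q) → c ≢ lookup s j → NeighbourAt B s j
neighbourAt {q} {n} {B} guaranteed {s} Bs j c c≢sj = record
  { point = u ; inB = Bu ; close = su ; differs = differs-at-j }
  where
  t : Vec (Fin q) n
  t = s [ j ]≔ c
  witness : Σ (Vec (Fin q) n) λ u → edit s u ≤ 1 × edit t u ≤ 1 × B u ≡ true
  witness = guaranteed s t (edit-[]≔≤1 s j c)
  u : Vec (Fin q) n
  u = proj₁ witness
  su : edit s u ≤ 1
  su = proj₁ (proj₂ witness)
  tu : edit t u ≤ 1
  tu = proj₁ (proj₂ (proj₂ witness))
  Bu : B u ≡ true
  Bu = proj₂ (proj₂ (proj₂ witness))

  differs-at-j : lookup s j ≢ lookup u j
  differs-at-j sj≡uj = false≢true (trans (sym Bs) (trans (cong B (lookup-extensionality s u s≗u)) Bu))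
    where
    false≢true : false ≢ true
    false≢true ()
    t-differs : lookup t j ≢ lookup u j
    t-differs tj≡uj = c≢sj (trans (sym (lookup∘update j s c)) (trans tj≡uj (sym sj≡uj)))
    s≗u : ∀ k → lookup s k ≡ lookup u k
    s≗u k with k ≟ j
    ... | yes refl = sj≡uj
    ... | no k≢j = trans (sym (lookup∘update′ k≢j s c))
                     (atMostOneMismatch-agree {s = t} {u} (edit≤1⇒atMostOneMismatch t u tu) t-differs k k≢j)

1≤card-ballInter : ∀ {q n} (B : Subset q n) {s} → B s ≡ true → 1 ≤ card (ballInter 1 s B)
1≤card-ballInter B {s} Bs =
  injective⇒≤-card (ballInter 1 s B) (λ _ → s) (λ { {zero} {zero} _ → refl })
    (λ _ → ballInter-intro B s Bs (subst (_≤ 1) (sym (edit-refl s)) z≤n))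

n≤card-ballInter : ∀ {q n} {B : Subset (2 + q) n} → Guaranteed 1 1 B →
  ∀ {s} → B s ≡ false → n ≤ card (ballInter 1 s B)
n≤card-ballInter {q} {n} {B} guaranteed {s} Bs =
  injective⇒≤-card (ballInter 1 s B) (point ∘ nb) nb-injective
    (λ j → ballInter-intro B s (inB (nb j)) (close (nb j)))
  where
  nb : (j : Fin n) → NeighbourAt B s j
  nb j = neighbourAt guaranteed Bs j (punchIn (lookup s j) zero) (punchInᵢ≢i (lookup s j) zero)
  nb-injective : Injective _≡_ _≡_ (point ∘ nb)
  nb-injective {i} {j} e = edit≤1⇒atMostOneMismatch s (point (nb j)) (close (nb j))
    (subst (λ v → lookup s i ≢ lookup v i) e (differs (nb i))) (differs (nb j))

^≤card : ∀ {q m} {B : Subset (2 + q) (suc m)} → Guaranteed 1 1 B → (2 + q) ^ m ≤ card B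
^≤card {q} {m} {B} guaranteed =
  injective⇒≤-card B (proj₁ ∘ extend ∘ decode m) extend-injective (proj₁ ∘ proj₂ ∘ extend ∘ decode m)
  where
  tail-extensionality : (u : Vec (Fin (2 + q)) (suc m)) (w : Vec (Fin (2 + q)) m) →
    (∀ k → lookup u (suc k) ≡ lookup w k) → tail u ≡ w
  tail-extensionality (_ ∷ u) w = lookup-extensionality u w

  extend : (w : Vec (Fin (2 + q)) m) → Σ (Vec (Fin (2 + q)) (suc m)) λ u → B u ≡ true × tail u ≡ w
  extend w with B (zero ∷ w) in Bw
  ... | true  = zero ∷ w , Bw , refl
  ... | false = point nb , inB nb , tail-extensionality (point nb) w (λ k → sym (agreesOff nb (suc k) λ ()))
    where
    nb : NeighbourAt B (zero ∷ w) zero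
    nb = neighbourAt guaranteed Bw zero (suc zero) λ ()

  extend-injective : Injective _≡_ _≡_ (proj₁ ∘ extend ∘ decode m)
  extend-injective {i} {j} e = decode-injective m
    (trans (sym (proj₂ (proj₂ (extend (decode m i))))) (trans (cong tail e) (proj₂ (proj₂ (extend (decode m j))))))

lemma9 : (q n : ℕ) → 2 ≤ q → 1 ≤ n → (B : Subset q n) → Guaranteed 1 1 B →
    ((s : Vec (Fin q) n) →
       (B s ≡ true → 1 ≤ card (ballInter 1 s B)) ×
       (B s ≡ false → n ≤ card (ballInter 1 s B)))
    × q ^ (n ∸ 1) ≤ card B
lemma9 (suc (suc q)) (suc m) (s≤s (s≤s z≤n)) (s≤s z≤n) B guaranteed =
  (λ s → 1≤card-ballInter B , n≤card-ballInter guaranteed) , ^≤card guaranteed
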